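{- Let $n,m,k,\ell,c$ be positive integers with $n<k+\ell<m$ and $n\le k$, and consider the equation $x^n+y^m=c\,x^k y^\ell$ in positive integers $x,y$. A pair $(x,y)$ of positive integers is a solution if and only if there exist positive integers $d,R,S,x_1$ such that $x=d\,x_1$, $y=d$, $d^{m-(k+\ell)}=RS$, $x_1^n=d^{k+\ell-n}S$, $S(1+R)=c\,x_1^k$, and $d^{m-n}=R\,x_1^n$.
   Context: A solution means an ordered pair $(x,y)$ of positive integers satisfying the equation. -}

-- Write the equation as x^n + y^m = x^n w with w = c x^(k-n) y^ℓ, a multiple of y.
-- Then y^m = x^n (w - 1), and w - 1 is coprime to y because y divides w, so w - 1
-- divides 1: hence y^m = x^n and w = 2.  Thus y divides 2, and then also x, and
-- d = y, R = 1, S = y^(m-k-ℓ), x₁ = x / y is a parametrisation.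
module Submission where

open import Data.Nat using (ℕ; zero; suc; z≤n; _+_; _*_; _∸_; _^_; _≤_; _<_; z<s; >-nonZero; >-nonZero⁻¹; nonTrivial⇒≢1)
open import Data.Nat.Properties
open import Data.Nat.Divisibility
open import Data.Nat.Coprimality using (Coprime; coprime-divisor)
open import Data.Nat.Primality using (Prime; prime[2]; euclidsLemma; prime⇒irreducible; prime⇒nonTrivial)
open import Data.Nat.Tactic.RingSolver using (solve-∀)
open import Data.Product using (_×_; _,_; proj₁; proj₂; ∃-syntax)
open import Data.Sum using (inj₁; inj₂)
open import Relation.Binary.PropositionalEquality using (_≡_; refl; sym; trans; cong; cong₂; subst; module ≡-Reasoning)
open import Relation.Nullary using (contradiction)
open import Function.Bundles using (_⇔_; mk⇔)

open ≡-Reasoning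

^-distribʳ-* : ∀ a b n → (a * b) ^ n ≡ a ^ n * b ^ n
^-distribʳ-* a b zero    = refl
^-distribʳ-* a b (suc n) = begin
  a * b * (a * b) ^ n         ≡⟨ cong (a * b *_) (^-distribʳ-* a b n) ⟩
  a * b * (a ^ n * b ^ n)     ≡⟨ interchange a b (a ^ n) (b ^ n) ⟩
  a * a ^ n * (b * b ^ n)     ∎
  where
  interchange : ∀ a b u v → a * b * (u * v) ≡ a * u * (b * v)
  interchange = solve-∀

^-split : ∀ a {i j} → i ≤ j → a ^ j ≡ a ^ i * a ^ (j ∸ i)
^-split a {i} {j} i≤j = trans (cong (a ^_) (sym (m+[n∸m]≡n i≤j))) (^-distribˡ-+-* a i (j ∸ i))

^-*-cancelˡ-≡ : ∀ {a} i {u v} → 0 < a → a ^ i * u ≡ a ^ i * v → u ≡ v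
^-*-cancelˡ-≡ {a} i {u} {v} a>0 = *-cancelˡ-≡ u v (a ^ i) {{m^n≢0 a i {{>-nonZero a>0}}}}

m∣m^n : ∀ m {n} → 0 < n → m ∣ m ^ n
m∣m^n m {suc n} _ = m∣m*n (m ^ n)

c*[d*x]^k*d^ℓ≡d^[k+ℓ]*[c*x^k] : ∀ c d x k ℓ → c * (d * x) ^ k * d ^ ℓ ≡ d ^ (k + ℓ) * (c * x ^ k)
c*[d*x]^k*d^ℓ≡d^[k+ℓ]*[c*x^k] c d x k ℓ = begin
  c * (d * x) ^ k * d ^ ℓ         ≡⟨ cong (λ t → c * t * d ^ ℓ) (^-distribʳ-* d x k) ⟩
  c * (d ^ k * x ^ k) * d ^ ℓ     ≡⟨ rearrange c (d ^ k) (x ^ k) (d ^ ℓ) ⟩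
  d ^ k * d ^ ℓ * (c * x ^ k)     ≡⟨ cong (_* (c * x ^ k)) (^-distribˡ-+-* d k ℓ) ⟨
  d ^ (k + ℓ) * (c * x ^ k)       ∎
  where
  rearrange : ∀ c a u b → c * (a * u) * b ≡ a * b * (c * u)
  rearrange = solve-∀

∣1+n⇒coprime : ∀ {d r} → d ∣ suc r → Coprime r d
∣1+n⇒coprime {r = r} d∣1+r {e} (e∣r , e∣d) =
  ∣1⇒≡1 (∣m+n∣m⇒∣n (subst (e ∣_) (+-comm 1 r) (∣-trans e∣d d∣1+r)) e∣r)

coprime∧∣^⇒≡1 : ∀ {r y} → Coprime r y → ∀ j → r ∣ y ^ j → r ≡ 1
coprime∧∣^⇒≡1 cop zero    r∣1  = ∣1⇒≡1 r∣1
coprime∧∣^⇒≡1 cop (suc j) r∣yʲ⁺¹ = coprime∧∣^⇒≡1 cop j (coprime-divisor cop r∣yʲ⁺¹)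

prime∣^⇒∣ : ∀ {p} x n → Prime p → p ∣ x ^ n → p ∣ x
prime∣^⇒∣ x zero    pr p∣1 = contradiction (∣1⇒≡1 p∣1) (nonTrivial⇒≢1 {{prime⇒nonTrivial pr}})
prime∣^⇒∣ x (suc n) pr p∣xⁿ⁺¹ with euclidsLemma x (x ^ n) pr p∣xⁿ⁺¹
... | inj₁ p∣x  = p∣x
... | inj₂ p∣xⁿ = prime∣^⇒∣ x n pr p∣xⁿ

∣prime∧^≡^⇒∣ : ∀ {p y x m n} → Prime p → y ∣ p → 0 < m → y ^ m ≡ x ^ n → y ∣ x
∣prime∧^≡^⇒∣ {p} {x = x} {n = n} pr y∣p m>0 yᵐ≡xⁿ with prime⇒irreducible pr y∣p
... | inj₁ refl = 1∣ x
... | inj₂ refl = prime∣^⇒∣ x n pr (subst (p ∣_) yᵐ≡xⁿ (m∣m^n p m>0))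

a+y^m≡a*w⇒y^m≡a×w≡2 : ∀ a {y} m {w} → 0 < y → y ∣ w → a + y ^ m ≡ a * w → y ^ m ≡ a × w ≡ 2
a+y^m≡a*w⇒y^m≡a×w≡2 a {y} m {zero} y>0 _ eq =
  contradiction (m^n≡0⇒m≡0 y m (m+n≡0⇒n≡0 a (trans eq (*-zeroʳ a)))) (>⇒≢ y>0)
a+y^m≡a*w⇒y^m≡a×w≡2 a {y} m {suc r} _ y∣w eq =
  trans yᵐ≡a*r (trans (cong (a *_) r≡1) (*-identityʳ a)) , cong suc r≡1
  where
  yᵐ≡a*r : y ^ m ≡ a * r
  yᵐ≡a*r = +-cancelˡ-≡ a (y ^ m) (a * r) (trans eq (*-suc a r))
  r≡1 : r ≡ 1
  r≡1 = coprime∧∣^⇒≡1 (∣1+n⇒coprime y∣w) m (divides a yᵐ≡a*r)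

Parametrised : (n m k ℓ c x y : ℕ) → Set
Parametrised n m k ℓ c x y =
  ∃[ d ] ∃[ R ] ∃[ S ] ∃[ x₁ ]
    (0 < d × 0 < R × 0 < S × 0 < x₁ ×
     x ≡ d * x₁ × y ≡ d ×
     d ^ (m ∸ (k + ℓ)) ≡ R * S ×
     x₁ ^ n ≡ d ^ (k + ℓ ∸ n) * S ×
     S * (1 + R) ≡ c * x₁ ^ k ×
     d ^ (m ∸ n) ≡ R * x₁ ^ n)

parametrised⇒solution : ∀ {n m k ℓ c x y} → n ≤ k + ℓ → k + ℓ ≤ m →
  Parametrised n m k ℓ c x y → x ^ n + y ^ m ≡ c * x ^ k * y ^ ℓ
parametrised⇒solution {n} {m} {k} {ℓ} {c} n≤k+ℓ k+ℓ≤m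
  (d , R , S , x₁ , _ , _ , _ , _ , refl , refl , dᵐ⁻ᵏ⁻ˡ≡RS , x₁ⁿ≡dᵏ⁺ˡ⁻ⁿS , S[1+R]≡cx₁ᵏ , _) = begin
  (d * x₁) ^ n + d ^ m                                  ≡⟨ cong₂ _+_ (^-distribʳ-* d x₁ n) (^-split d k+ℓ≤m) ⟩
  d ^ n * x₁ ^ n + d ^ (k + ℓ) * d ^ (m ∸ (k + ℓ))      ≡⟨ cong₂ (λ u v → d ^ n * u + d ^ (k + ℓ) * v) x₁ⁿ≡dᵏ⁺ˡ⁻ⁿS dᵐ⁻ᵏ⁻ˡ≡RS ⟩
  d ^ n * (d ^ (k + ℓ ∸ n) * S) + d ^ (k + ℓ) * (R * S) ≡⟨ cong (_+ d ^ (k + ℓ) * (R * S)) dⁿ[dᵏ⁺ˡ⁻ⁿS]≡dᵏ⁺ˡS ⟩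
  d ^ (k + ℓ) * S + d ^ (k + ℓ) * (R * S)               ≡⟨ factor (d ^ (k + ℓ)) S R ⟩
  d ^ (k + ℓ) * (S * (1 + R))                           ≡⟨ cong (d ^ (k + ℓ) *_) S[1+R]≡cx₁ᵏ ⟩
  d ^ (k + ℓ) * (c * x₁ ^ k)                            ≡⟨ c*[d*x]^k*d^ℓ≡d^[k+ℓ]*[c*x^k] c d x₁ k ℓ ⟨
  c * (d * x₁) ^ k * d ^ ℓ                              ∎
  where
  dⁿ[dᵏ⁺ˡ⁻ⁿS]≡dᵏ⁺ˡS : d ^ n * (d ^ (k + ℓ ∸ n) * S) ≡ d ^ (k + ℓ) * S
  dⁿ[dᵏ⁺ˡ⁻ⁿS]≡dᵏ⁺ˡS = trans (sym (*-assoc (d ^ n) _ S)) (cong (_* S) (sym (^-split d n≤k+ℓ)))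
  factor : ∀ a s r → a * s + a * (r * s) ≡ a * (s * (1 + r))
  factor = solve-∀

power-solution⇒parametrised : ∀ {n m k ℓ c x y} x₁ → n ≤ k + ℓ → k + ℓ ≤ m → 0 < y → 0 < x₁ →
  x ≡ y * x₁ → y ^ m ≡ x ^ n → x ^ n + y ^ m ≡ c * x ^ k * y ^ ℓ → Parametrised n m k ℓ c x y
power-solution⇒parametrised {n} {m} {k} {ℓ} {c} {_} {y} x₁ n≤k+ℓ k+ℓ≤m y>0 x₁>0 refl yᵐ≡xⁿ eq =
  y , 1 , S , x₁ , y>0 , z<s , m^n>0 y {{>-nonZero y>0}} (m ∸ (k + ℓ)) , x₁>0 , refl , refl ,
  sym (*-identityˡ S) , x₁ⁿ≡yᵏ⁺ˡ⁻ⁿS , S*2≡cx₁ᵏ , trans yᵐ⁻ⁿ≡x₁ⁿ (sym (*-identityˡ _))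
  where
  S : ℕ
  S = y ^ (m ∸ (k + ℓ))
  yⁿx₁ⁿ≡yᵐ : y ^ n * x₁ ^ n ≡ y ^ m
  yⁿx₁ⁿ≡yᵐ = trans (sym (^-distribʳ-* y x₁ n)) (sym yᵐ≡xⁿ)
  yᵐ⁻ⁿ≡x₁ⁿ : y ^ (m ∸ n) ≡ x₁ ^ n
  yᵐ⁻ⁿ≡x₁ⁿ = ^-*-cancelˡ-≡ n y>0 (trans (sym (^-split y (≤-trans n≤k+ℓ k+ℓ≤m))) (sym yⁿx₁ⁿ≡yᵐ))
  x₁ⁿ≡yᵏ⁺ˡ⁻ⁿS : x₁ ^ n ≡ y ^ (k + ℓ ∸ n) * S
  x₁ⁿ≡yᵏ⁺ˡ⁻ⁿS = ^-*-cancelˡ-≡ n y>0 (begin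
    y ^ n * x₁ ^ n                 ≡⟨ yⁿx₁ⁿ≡yᵐ ⟩
    y ^ m                          ≡⟨ ^-split y k+ℓ≤m ⟩
    y ^ (k + ℓ) * S                ≡⟨ cong (_* S) (^-split y n≤k+ℓ) ⟩
    y ^ n * y ^ (k + ℓ ∸ n) * S    ≡⟨ *-assoc (y ^ n) _ S ⟩
    y ^ n * (y ^ (k + ℓ ∸ n) * S)  ∎)
  S*2≡cx₁ᵏ : S * (1 + 1) ≡ c * x₁ ^ k
  S*2≡cx₁ᵏ = ^-*-cancelˡ-≡ (k + ℓ) y>0 (begin
    y ^ (k + ℓ) * (S * 2)              ≡⟨ double (y ^ (k + ℓ)) S ⟩
    y ^ (k + ℓ) * S + y ^ (k + ℓ) * S  ≡⟨ cong (λ t → t + t) (^-split y k+ℓ≤m) ⟨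
    y ^ m + y ^ m                      ≡⟨ cong (_+ y ^ m) yᵐ≡xⁿ ⟩
    (y * x₁) ^ n + y ^ m               ≡⟨ eq ⟩
    c * (y * x₁) ^ k * y ^ ℓ           ≡⟨ c*[d*x]^k*d^ℓ≡d^[k+ℓ]*[c*x^k] c y x₁ k ℓ ⟩
    y ^ (k + ℓ) * (c * x₁ ^ k)         ∎)
    where
    double : ∀ a s → a * (s * 2) ≡ a * s + a * s
    double = solve-∀

solution⇒parametrised : ∀ {n m k ℓ c x y} → n ≤ k → 0 < ℓ → k + ℓ < m → 0 < x → 0 < y →
  x ^ n + y ^ m ≡ c * x ^ k * y ^ ℓ → Parametrised n m k ℓ c x y
solution⇒parametrised {n} {m} {k} {ℓ} {c} {x} {y} n≤k ℓ>0 k+ℓ<m x>0 y>0 eq =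
  power-solution⇒parametrised {n} {m} {k} {ℓ} {c} (quotient y∣x) (≤-trans n≤k (m≤m+n k ℓ)) (<⇒≤ k+ℓ<m) y>0
    (>-nonZero⁻¹ _ {{quotient≢0 y∣x {{>-nonZero x>0}}}}) (m∣n⇒n≡m*quotient y∣x) yᵐ≡xⁿ eq
  where
  w : ℕ
  w = c * x ^ (k ∸ n) * y ^ ℓ
  x^k-factor : c * x ^ k * y ^ ℓ ≡ x ^ n * w
  x^k-factor = begin
    c * x ^ k * y ^ ℓ                  ≡⟨ cong (λ t → c * t * y ^ ℓ) (^-split x n≤k) ⟩
    c * (x ^ n * x ^ (k ∸ n)) * y ^ ℓ  ≡⟨ rearrange c (x ^ n) (x ^ (k ∸ n)) (y ^ ℓ) ⟩
    x ^ n * w                          ∎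
    where
    rearrange : ∀ c a b z → c * (a * b) * z ≡ a * (c * b * z)
    rearrange = solve-∀
  y∣w : y ∣ w
  y∣w = ∣n⇒∣m*n (c * x ^ (k ∸ n)) (m∣m^n y ℓ>0)
  yᵐ≡xⁿ×w≡2 : y ^ m ≡ x ^ n × w ≡ 2
  yᵐ≡xⁿ×w≡2 = a+y^m≡a*w⇒y^m≡a×w≡2 (x ^ n) m y>0 y∣w (trans eq x^k-factor)
  yᵐ≡xⁿ : y ^ m ≡ x ^ n
  yᵐ≡xⁿ = proj₁ yᵐ≡xⁿ×w≡2
  y∣x : y ∣ x
  y∣x = ∣prime∧^≡^⇒∣ {n = n} prime[2] (subst (y ∣_) (proj₂ yᵐ≡xⁿ×w≡2) y∣w) (≤-<-trans z≤n k+ℓ<m) yᵐ≡xⁿ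

theorem4 : (n m k ℓ c : ℕ) → 0 < n → 0 < m → 0 < k → 0 < ℓ → 0 < c →
    n < k + ℓ → k + ℓ < m → n ≤ k →
    (x y : ℕ) → 0 < x → 0 < y →
    (x ^ n + y ^ m ≡ c * x ^ k * y ^ ℓ)
    ⇔
    (∃[ d ] ∃[ R ] ∃[ S ] ∃[ x₁ ]
      (0 < d × 0 < R × 0 < S × 0 < x₁ ×
       x ≡ d * x₁ × y ≡ d ×
       d ^ (m ∸ (k + ℓ)) ≡ R * S ×
       x₁ ^ n ≡ d ^ (k + ℓ ∸ n) * S ×
       S * (1 + R) ≡ c * x₁ ^ k ×
       d ^ (m ∸ n) ≡ R * x₁ ^ n))
theorem4 n m k ℓ c _ _ _ ℓ>0 _ n<k+ℓ k+ℓ<m n≤k x y x>0 y>0 =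
  mk⇔ (solution⇒parametrised {n} {m} {k} {ℓ} {c} n≤k ℓ>0 k+ℓ<m x>0 y>0)
      (parametrised⇒solution {n} {m} {k} {ℓ} {c} (<⇒≤ n<k+ℓ) (<⇒≤ k+ℓ<m))
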